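{- Let $n\ge 2$ and let $P$ be a set of $2n$ points in regular wheel configuration. If $T_1,\dots,T_n$ are plane spanning trees on $P$ whose edge sets partition the edge set of $GW_{2n}$, then each $T_i$, $i=1,\dots,n$, has at least one boundary edge.
   Context: A set $P$ of $2n$ points is in regular wheel configuration if $2n-1$ of its points are the vertices of a regular $(2n-1)$-gon inscribed in a circle $C$ and the remaining point $x$ is the centre of $C$. $GW_{2n}$ is the complete geometric graph on $P$ (all pairs joined by straight-line segments). A plane spanning tree on $P$ is a spanning tree of $GW_{2n}$ whose edges pairwise do not cross (meet only at common endpoints). A boundary edge is an edge joining two points consecutive on $C$. Edge sets partition $E(GW_{2n})$ if they are pairwise disjoint with union $E(GW_{2n})$. -}

module Defs where

open import Data.Nat using (ℕ; zero; suc; _+_; _*_; _∸_; _<ᵇ_; _⊓_; _⊔_; _≡ᵇ_)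
open import Data.Bool using (Bool; true; false; if_then_else_; not; _∧_; _xor_)
open import Data.Fin using (Fin; zero; suc; toℕ)
open import Data.List using (List; map)
open import Data.Nat.ListAction using (sum)
open import Data.List using () renaming (allFin to allFinL)
open import Data.Product using (Σ; _×_; _,_)
open import Data.Sum using (_⊎_)
open import Relation.Binary.PropositionalEquality using (_≡_; _≢_)

-- Regular wheel configuration with m = 2n-1 rim vertices.
-- Points are  Fin (suc m):  zero = the centre x of C,
--                            suc k = the k-th vertex of the regular m-gon
--                                    (vertices numbered 0..m-1 in cyclic order).

Point : ℕ → Set
Point m = Fin (suc m)

strictBetween : ℕ → ℕ → ℕ → Bool
strictBetween a b x = (a <ᵇ x) ∧ (x <ᵇ b)

distinctᵇ : ℕ → ℕ → Bool
distinctᵇ a b = not (a ≡ᵇ b)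

-- Two chords {a,b}, {c,d} of a convex polygon (vertex labels < m) cross
-- iff all four endpoints are distinct and they interleave in cyclic order.
chordsCross : ℕ → ℕ → ℕ → ℕ → Bool
chordsCross a b c d =
  distinctᵇ a c ∧ distinctᵇ a d ∧ distinctᵇ b c ∧ distinctᵇ b d ∧
  (strictBetween (a ⊓ b) (a ⊔ b) c xor strictBetween (a ⊓ b) (a ⊔ b) d)

-- The spoke from the centre to vertex v crosses the chord {a,b} iff v is
-- not an endpoint of the chord and v lies strictly inside the minor arc
-- cut off by the chord (the centre lies on the side of the major arc;
-- m odd, so no chord passes through the centre).
spokeCross : ℕ → ℕ → ℕ → ℕ → Bool
spokeCross m v a b =
  distinctᵇ v a ∧ distinctᵇ v b ∧
  (if (2 * ((a ⊔ b) ∸ (a ⊓ b))) <ᵇ m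
     then strictBetween (a ⊓ b) (a ⊔ b) v
     else not (strictBetween (a ⊓ b) (a ⊔ b) v))

-- cross m p q r s : the (closed) segments pq and rs meet in a point that is
-- not a common endpoint (i.e. the segments cross).  Segments sharing an
-- endpoint only meet at it (no three points are collinear except that no
-- two rim vertices are antipodal, as m is odd).
cross : (m : ℕ) → Point m → Point m → Point m → Point m → Bool
cross m zero zero r s = false
cross m zero (suc v) zero s = false
cross m zero (suc v) (suc a) zero = false
cross m zero (suc v) (suc a) (suc b) = spokeCross m (toℕ v) (toℕ a) (toℕ b)
cross m (suc v) zero zero s = false
cross m (suc v) zero (suc a) zero = false
cross m (suc v) zero (suc a) (suc b) = spokeCross m (toℕ v) (toℕ a) (toℕ b)
cross m (suc a) (suc b) zero zero = false
cross m (suc a) (suc b) zero (suc v) = spokeCross m (toℕ v) (toℕ a) (toℕ b)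
cross m (suc a) (suc b) (suc v) zero = spokeCross m (toℕ v) (toℕ a) (toℕ b)
cross m (suc a) (suc b) (suc c) (suc d) = chordsCross (toℕ a) (toℕ b) (toℕ c) (toℕ d)

Graph : ℕ → Set
Graph m = Point m → Point m → Bool

IsSimple : (m : ℕ) → Graph m → Set
IsSimple m G = (∀ p q → G p q ≡ G q p) × (∀ p → G p p ≡ false)

data Reach {m : ℕ} (G : Graph m) (p : Point m) : Point m → Set where
  here : Reach G p p
  step : ∀ {q r} → Reach G p q → G q r ≡ true → Reach G p r

Connected : (m : ℕ) → Graph m → Set
Connected m G = ∀ p q → Reach G p q

-- number of ordered pairs (p,q) with G p q = true (= 2 · #edges for simple G)
orderedEdgeCount : (m : ℕ) → Graph m → ℕ
orderedEdgeCount m G =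
  sum (map (λ p → sum (map (λ q → if G p q then 1 else 0) (allFinL (suc m))))
           (allFinL (suc m)))

IsSpanningTree : (m : ℕ) → Graph m → Set
IsSpanningTree m G = IsSimple m G × Connected m G × (orderedEdgeCount m G ≡ 2 * m)

IsPlane : (m : ℕ) → Graph m → Set
IsPlane m G = ∀ p q r s → G p q ≡ true → G r s ≡ true → cross m p q r s ≡ false

IsPlaneSpanningTree : (m : ℕ) → Graph m → Set
IsPlaneSpanningTree m G = IsPlane m G × IsSpanningTree m G

PartitionsComplete : (m k : ℕ) → (Fin k → Graph m) → Set
PartitionsComplete m k T =
  ∀ p q → p ≢ q →
    Σ (Fin k) λ i → (T i p q ≡ true) × (∀ j → T j p q ≡ true → j ≡ i)

ConsecutiveOnC : (m : ℕ) → Fin m → Fin m → Set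
ConsecutiveOnC m a b = (suc (toℕ a) ≡ toℕ b) ⊎ ((suc (toℕ a) ≡ m) × (toℕ b ≡ 0))

HasBoundaryEdge : (m : ℕ) → Graph m → Set
HasBoundaryEdge m G =
  Σ (Fin m) λ a → Σ (Fin m) λ b → ConsecutiveOnC m a b × (G (suc a) (suc b) ≡ true)

{-# OPTIONS --safe #-}
-- Fix a tree T. Another tree is connected, so it contains some spoke xv, and then T does not:
-- the neighbour of v on the T-path from x to v is a rim vertex w, so vw is a chord of T.
-- A chord cuts off an arc of C on the side away from the centre x. If that arc is longer than
-- a single side of the polygon, it has a rim vertex u in its interior. The spoke xu would cross
-- the chord, so u has a rim neighbour in T, which by planarity lies on the closed arc, and the
-- new chord cuts off a strictly shorter arc. Descending on the arc length ends at a boundary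
-- edge.
module Submission where

open import Defs
open import Data.Nat using (ℕ; _≤_; _*_; _∸_)
open import Data.Fin using (Fin)

open import Data.Bool using (Bool; true; false; T; not; _∧_; _xor_; if_then_else_)
open import Data.Bool.Properties using (T-≡)
open import Data.Fin using (zero; suc; toℕ; fromℕ<; punchIn)
open import Data.Fin.Properties using (toℕ<n; toℕ-fromℕ<; toℕ-injective; punchInᵢ≢i)
open import Data.Nat using (suc; s≤s; _<_; _+_; _⊓_; _⊔_; _<ᵇ_; _≡ᵇ_; ∣_-_∣; z≤n)
open import Data.Nat.Induction using (<-wellFounded)
open import Data.Nat.Properties
open import Data.Product using (Σ; _×_; _,_; map)
open import Data.Sum using (_⊎_; inj₁; inj₂; [_,_]; map₂)
open import Function.Bundles using (_⇔_; mk⇔; Equivalence)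
open import Function.Construct.Composition using (_⇔-∘_)
open import Induction.WellFounded using (Acc; acc)
open import Relation.Binary using (tri<; tri≈; tri>)
open import Relation.Binary.PropositionalEquality using (_≡_; _≢_; refl; sym; trans; cong; cong₂; subst; ≢-sym)
open import Relation.Nullary using (yes; no; contradiction)

open Equivalence using (to; from)

private variable a b c d m v w x y : ℕ

∸-<-nested : a ≤ c → c ≤ d → d ≤ b → a < c ⊎ d < b → d ∸ c < b ∸ a
∸-<-nested {c = c} {d = d} {b = b} a≤c c≤d d≤b (inj₁ a<c) =
  ≤-<-trans (∸-monoˡ-≤ c d≤b) (∸-monoʳ-< a<c (≤-trans c≤d d≤b))
∸-<-nested {d = d} {b = b} a≤c c≤d d≤b (inj₂ d<b) =
  <-≤-trans (∸-monoˡ-< d<b c≤d) (∸-monoʳ-≤ b a≤c)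

∣-∣<-inner : a < x → x < b → a ≤ y → y ≤ b → ∣ x - y ∣ < b ∸ a
∣-∣<-inner {x = x} {y = y} a<x x<b a≤y y≤b with ≤-total x y
... | inj₁ x≤y rewrite m≤n⇒∣m-n∣≡n∸m x≤y = ∸-<-nested (<⇒≤ a<x) x≤y y≤b (inj₁ a<x)
... | inj₂ y≤x rewrite m≤n⇒∣n-m∣≡n∸m y≤x = ∸-<-nested a≤y y≤x (<⇒≤ x<b) (inj₂ x<b)

∣-∣<-range : a ≤ x → x < b → a ≤ y → y < b → ∣ x - y ∣ < b ∸ a
∣-∣<-range {x = x} {y = y} a≤x x<b a≤y y<b with ≤-total x y
... | inj₁ x≤y rewrite m≤n⇒∣m-n∣≡n∸m x≤y = ∸-<-nested a≤x x≤y (<⇒≤ y<b) (inj₂ y<b)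
... | inj₂ y≤x rewrite m≤n⇒∣n-m∣≡n∸m y≤x = ∸-<-nested a≤y y≤x (<⇒≤ x<b) (inj₂ x<b)

minorArc : ℕ → ℕ → ℕ
minorArc m d = d ⊓ (m ∸ d)

<ᵇ≡true⇒< : (x <ᵇ y) ≡ true → x < y
<ᵇ≡true⇒< {x} {y} eq = <ᵇ⇒< x y (from T-≡ eq)

<ᵇ≡false⇒≥ : (x <ᵇ y) ≡ false → y ≤ x
<ᵇ≡false⇒≥ eq = ≮⇒≥ (λ x<y → subst T eq (<⇒<ᵇ x<y))

2*d≡d+d : ∀ d → 2 * d ≡ d + d
2*d≡d+d d = cong (d +_) (+-identityʳ d)

minorArc-short : (2 * d <ᵇ m) ≡ true → minorArc m d ≡ d
minorArc-short {d} {m} short =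
  m≤n⇒m⊓n≡m (m+n≤o⇒m≤o∸n d (<⇒≤ (subst (_< m) (2*d≡d+d d) (<ᵇ≡true⇒< short))))

minorArc-long : (2 * d <ᵇ m) ≡ false → minorArc m d ≡ m ∸ d
minorArc-long {d} {m} long =
  m≥n⇒m⊓n≡n (m≤n+o⇒m∸n≤o m d (subst (m ≤_) (2*d≡d+d d) (<ᵇ≡false⇒≥ long)))

minorArc-straddling : c ≤ a → a ≤ b → b ≤ d → d ≤ m → c < a ⊎ b < d →
                      minorArc m (d ∸ c) < m ∸ (b ∸ a)
minorArc-straddling {c} {a} {b} {d} {m} c≤a a≤b b≤d d≤m strict =
  ≤-<-trans (m⊓n≤n (d ∸ c) (m ∸ (d ∸ c)))
            (∸-monoʳ-< (∸-<-nested c≤a a≤b b≤d strict) (≤-trans (m∸n≤m d c) d≤m))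

-- The rim labels strictly inside (OpenArc) or on (ClosedArc) the arc that the chord {a, b},
-- a < b, cuts off away from the centre: the arc between a and b when s = (2 (b ∸ a) <ᵇ m),
-- as in spokeCross, and the arc through 0 and m ∸ 1 otherwise.
OpenArc : Bool → ℕ → ℕ → ℕ → Set
OpenArc true  a b x = a < x × x < b
OpenArc false a b x = x < a ⊎ b < x

ClosedArc : Bool → ℕ → ℕ → ℕ → Set
ClosedArc true  a b x = a ≤ x × x ≤ b
ClosedArc false a b x = x ≤ a ⊎ b ≤ x

minorArc-outer : a < b → b < m → x < m → y < m → OpenArc false a b x → ClosedArc false a b y →
                 minorArc m ∣ x - y ∣ < m ∸ (b ∸ a)
minorArc-outer {a} {b} {m} {x} {y} a<b b<m x<m y<m (inj₁ x<a) (inj₁ y≤a) =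
  begin-strict
    minorArc m ∣ x - y ∣ ≤⟨ m⊓n≤m _ _ ⟩
    ∣ x - y ∣            ≤⟨ ∣m-n∣≤m⊔n x y ⟩
    x ⊔ y                ≤⟨ ⊔-lub (<⇒≤ x<a) y≤a ⟩
    a                    <⟨ a<m∸[b∸a] ⟩
    m ∸ (b ∸ a)          ∎
  where
  open ≤-Reasoning
  a<m∸[b∸a] : a < m ∸ (b ∸ a)
  a<m∸[b∸a] = m+n≤o⇒m≤o∸n (suc a) (subst (_≤ m) (sym (cong suc (m+[n∸m]≡n (<⇒≤ a<b)))) b<m)
minorArc-outer {a} {b} {m} {x} {y} a<b b<m x<m y<m (inj₂ b<x) (inj₂ b≤y) =
  begin-strict
    minorArc m ∣ x - y ∣ ≤⟨ m⊓n≤m _ _ ⟩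
    ∣ x - y ∣            <⟨ ∣-∣<-range (<⇒≤ b<x) x<m b≤y y<m ⟩
    m ∸ b                ≤⟨ ∸-monoʳ-≤ m (m∸n≤m b a) ⟩
    m ∸ (b ∸ a)          ∎
  where open ≤-Reasoning
minorArc-outer a<b b<m x<m y<m (inj₁ x<a) (inj₂ b≤y)
  rewrite m≤n⇒∣m-n∣≡n∸m (<⇒≤ (<-≤-trans (<-trans x<a a<b) b≤y)) =
  minorArc-straddling (<⇒≤ x<a) (<⇒≤ a<b) b≤y (<⇒≤ y<m) (inj₁ x<a)
minorArc-outer a<b b<m x<m y<m (inj₂ b<x) (inj₁ y≤a)
  rewrite m≤n⇒∣n-m∣≡n∸m (<⇒≤ (≤-<-trans y≤a (<-trans a<b b<x))) =
  minorArc-straddling y≤a (<⇒≤ a<b) (<⇒≤ b<x) (<⇒≤ x<m) (inj₂ b<x)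

minorArc-shrinks : ∀ s → (2 * (b ∸ a) <ᵇ m) ≡ s → a < b → b < m → x < m → y < m →
                   OpenArc s a b x → ClosedArc s a b y → minorArc m ∣ x - y ∣ < minorArc m (b ∸ a)
minorArc-shrinks {b} {a} {m} {x} {y} true short _ _ _ _ (a<x , x<b) (a≤y , y≤b) =
  subst (minorArc m ∣ x - y ∣ <_) (sym (minorArc-short short))
        (≤-<-trans (m⊓n≤m _ _) (∣-∣<-inner a<x x<b a≤y y≤b))
minorArc-shrinks {b} {a} {m} {x} {y} false long a<b b<m x<m y<m x-open y-closed =
  subst (minorArc m ∣ x - y ∣ <_) (sym (minorArc-long long))
        (minorArc-outer a<b b<m x<m y<m x-open y-closed)

boundary⊎openArcVertex : ∀ s (a b : Fin m) → toℕ a < toℕ b →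
  ConsecutiveOnC m a b ⊎ ConsecutiveOnC m b a ⊎ Σ (Fin m) λ x → OpenArc s (toℕ a) (toℕ b) (toℕ x)
boundary⊎openArcVertex {m} true a b a<b with m≤n⇒m<n∨m≡n a<b
... | inj₂ a→b = inj₁ (inj₁ a→b)
... | inj₁ gap = inj₂ (inj₂ (a+1 , a<a+1 , a+1<b))
  where
  a+1 : Fin m
  a+1 = fromℕ< (<-trans gap (toℕ<n b))
  a<a+1 : toℕ a < toℕ a+1
  a<a+1 = subst (toℕ a <_) (sym (toℕ-fromℕ< _)) (n<1+n (toℕ a))
  a+1<b : toℕ a+1 < toℕ b
  a+1<b = subst (_< toℕ b) (sym (toℕ-fromℕ< _)) gap
boundary⊎openArcVertex {m} false a b a<b with suc (toℕ b) <? m | toℕ a ≟ 0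
... | yes 1+b<m | _       = inj₂ (inj₂ (fromℕ< 1+b<m , inj₂ b<b+1))
  where
  b<b+1 : toℕ b < toℕ (fromℕ< 1+b<m)
  b<b+1 = subst (toℕ b <_) (sym (toℕ-fromℕ< _)) (n<1+n (toℕ b))
... | no 1+b≮m  | yes a≡0 = inj₂ (inj₁ (inj₂ (≤-antisym (toℕ<n b) (≮⇒≥ 1+b≮m) , a≡0)))
... | no _      | no a≢0  = inj₂ (inj₂ (first , inj₁ first<a))
  where
  first : Fin m
  first = fromℕ< (≤-<-trans z≤n (toℕ<n b))
  first<a : toℕ first < toℕ a
  first<a = subst (_< toℕ a) (sym (toℕ-fromℕ< _)) (n≢0⇒n>0 a≢0)

∧≡true⇒ : ∀ {p q} → p ∧ q ≡ true → p ≡ true × q ≡ true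
∧≡true⇒ {true} q≡true = refl , q≡true

if-agree⇔ : ∀ {o s} → (if o then s else not s) ≡ true ⇔ s ≡ o
if-agree⇔ {true}  {true}  = mk⇔ (λ _ → refl) (λ _ → refl)
if-agree⇔ {false} {false} = mk⇔ (λ _ → refl) (λ _ → refl)
if-agree⇔ {true}  {false} = mk⇔ (λ ()) (λ ())
if-agree⇔ {false} {true}  = mk⇔ (λ ()) (λ ())

xor≡false⇒≡ : ∀ p q → p xor q ≡ false → q ≡ p
xor≡false⇒≡ true  true  _ = refl
xor≡false⇒≡ false false _ = refl

distinctᵇ⇔≢ : distinctᵇ x y ≡ true ⇔ x ≢ y
distinctᵇ⇔≢ {x} {y} with x ≡ᵇ y in eq
... | true  = mk⇔ (λ ()) (λ x≢y → contradiction (≡ᵇ⇒≡ x y (from T-≡ eq)) x≢y)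
... | false = mk⇔ (λ _ x≡y → subst T eq (≡⇒≡ᵇ x y x≡y)) (λ _ → refl)

strictBetween≡true⇔ : strictBetween a b x ≡ true ⇔ (a < x × x < b)
strictBetween≡true⇔ {a} {b} {x} with a <ᵇ x in a<ᵇx | x <ᵇ b in x<ᵇb
... | true  | true  = mk⇔ (λ _ → <ᵇ≡true⇒< a<ᵇx , <ᵇ≡true⇒< x<ᵇb) (λ _ → refl)
... | true  | false = mk⇔ (λ ()) (λ (_ , x<b) → contradiction x<b (≤⇒≯ (<ᵇ≡false⇒≥ x<ᵇb)))
... | false | _     = mk⇔ (λ ()) (λ (a<x , _) → contradiction a<x (≤⇒≯ (<ᵇ≡false⇒≥ a<ᵇx)))

strictBetween≡false⇔ : strictBetween a b x ≡ false ⇔ (x ≤ a ⊎ b ≤ x)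
strictBetween≡false⇔ {a} {b} {x} with a <ᵇ x in a<ᵇx | x <ᵇ b in x<ᵇb
... | true  | true  = mk⇔ (λ ())
  [ (λ x≤a → contradiction (<ᵇ≡true⇒< a<ᵇx) (≤⇒≯ x≤a))
  , (λ b≤x → contradiction (<ᵇ≡true⇒< x<ᵇb) (≤⇒≯ b≤x))
  ]
... | true  | false = mk⇔ (λ _ → inj₂ (<ᵇ≡false⇒≥ x<ᵇb)) (λ _ → refl)
... | false | _     = mk⇔ (λ _ → inj₁ (<ᵇ≡false⇒≥ a<ᵇx)) (λ _ → refl)

spokeCross≡true⇔ : a ≤ b →
  spokeCross m x a b ≡ true ⇔ (x ≢ a × x ≢ b × strictBetween a b x ≡ (2 * (b ∸ a) <ᵇ m))
spokeCross≡true⇔ {a} {b} {m} {x} a≤b rewrite m≤n⇒m⊓n≡m a≤b | m≤n⇒m⊔n≡n a≤b = mk⇔ decode encode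
  where
  short : Bool
  short = 2 * (b ∸ a) <ᵇ m

  crossing : Bool
  crossing = distinctᵇ x a ∧ distinctᵇ x b ∧ (if short then strictBetween a b x else not (strictBetween a b x))

  decode : crossing ≡ true → x ≢ a × x ≢ b × strictBetween a b x ≡ short
  decode crosses with ∧≡true⇒ crosses
  ... | x≢ᵇa , rest with ∧≡true⇒ rest
  ... | x≢ᵇb , agree = to distinctᵇ⇔≢ x≢ᵇa , to distinctᵇ⇔≢ x≢ᵇb , to if-agree⇔ agree

  encode : x ≢ a × x ≢ b × strictBetween a b x ≡ short → crossing ≡ true
  encode (x≢a , x≢b , agree) =
    cong₂ _∧_ (from distinctᵇ⇔≢ x≢a) (cong₂ _∧_ (from distinctᵇ⇔≢ x≢b) (from if-agree⇔ agree))

openArc⇔ : a ≤ b → ∀ s → (x ≢ a × x ≢ b × strictBetween a b x ≡ s) ⇔ OpenArc s a b x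
openArc⇔ a≤b true = mk⇔ (λ (_ , _ , between) → to strictBetween≡true⇔ between)
  (λ (a<x , x<b) → >⇒≢ a<x , <⇒≢ x<b , from strictBetween≡true⇔ (a<x , x<b))
openArc⇔ {a} {b} {x} a≤b false = mk⇔ decode encode
  where
  decode : x ≢ a × x ≢ b × strictBetween a b x ≡ false → x < a ⊎ b < x
  decode (x≢a , x≢b , outside) with to strictBetween≡false⇔ outside
  ... | inj₁ x≤a = inj₁ (≤∧≢⇒< x≤a x≢a)
  ... | inj₂ b≤x = inj₂ (≤∧≢⇒< b≤x (≢-sym x≢b))

  encode : x < a ⊎ b < x → x ≢ a × x ≢ b × strictBetween a b x ≡ false
  encode (inj₁ x<a) =
    <⇒≢ x<a , <⇒≢ (<-≤-trans x<a a≤b) , from (strictBetween≡false⇔ {b = b}) (inj₁ (<⇒≤ x<a))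
  encode (inj₂ b<x) =
    >⇒≢ (≤-<-trans a≤b b<x) , >⇒≢ b<x , from strictBetween≡false⇔ (inj₂ (<⇒≤ b<x))

closedArc : a ≤ b → ∀ s → x ≡ a ⊎ x ≡ b ⊎ strictBetween a b x ≡ s → ClosedArc s a b x
closedArc a≤b true  (inj₁ refl)        = ≤-refl , a≤b
closedArc a≤b true  (inj₂ (inj₁ refl)) = a≤b , ≤-refl
closedArc a≤b true  (inj₂ (inj₂ between)) = map <⇒≤ <⇒≤ (to strictBetween≡true⇔ between)
closedArc a≤b false (inj₁ refl)        = inj₁ ≤-refl
closedArc a≤b false (inj₂ (inj₁ refl)) = inj₂ ≤-refl
closedArc a≤b false (inj₂ (inj₂ outside)) = to strictBetween≡false⇔ outside

chordsCross≡false : a ≤ b → v ≢ a → v ≢ b → chordsCross a b v w ≡ false →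
                    w ≡ a ⊎ w ≡ b ⊎ strictBetween a b w ≡ strictBetween a b v
chordsCross≡false {a} {b} {v} {w} a≤b v≢a v≢b no-cross
  rewrite m≤n⇒m⊓n≡m a≤b | m≤n⇒m⊔n≡n a≤b
        | from (distinctᵇ⇔≢ {a} {v}) (≢-sym v≢a) | from (distinctᵇ⇔≢ {b} {v}) (≢-sym v≢b)
  with w ≟ a | w ≟ b
... | yes w≡a | _       = inj₁ w≡a
... | no _    | yes w≡b = inj₂ (inj₁ w≡b)
... | no w≢a  | no w≢b
  rewrite from (distinctᵇ⇔≢ {a} {w}) (≢-sym w≢a) | from (distinctᵇ⇔≢ {b} {w}) (≢-sym w≢b) =
  inj₂ (inj₂ (xor≡false⇒≡ _ _ no-cross))

incoming : {G : Graph m} {p q : Point m} → Reach G p q → p ≢ q → Σ (Point m) λ r → G r q ≡ true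
incoming here          p≢p = contradiction refl p≢p
incoming (step {r} _ e) _  = r , e

connected⇒spoke : {G : Graph m} → (∀ p → G p p ≡ false) → Connected m G →
                  Fin m → Σ (Fin m) λ v → G (suc v) zero ≡ true
connected⇒spoke G-irrefl connected x with incoming (connected (suc x) zero) (λ ())
... | zero  , loop  = contradiction (trans (sym loop) (G-irrefl zero)) λ ()
... | suc v , spoke = v , spoke

partition-unique : ∀ {k} {T : Fin k → Graph m} {p q i j} → PartitionsComplete m k T → p ≢ q →
                   T i p q ≡ true → T j p q ≡ true → i ≡ j
partition-unique partition p≢q Tᵢpq Tⱼpq with partition _ _ p≢q
... | _ , _ , unique = trans (unique _ Tᵢpq) (sym (unique _ Tⱼpq))

record Chord (m : ℕ) (G : Graph m) : Set where
  constructor chord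
  field
    lo hi : Fin m
    lo<hi : toℕ lo < toℕ hi
    edge  : G (suc lo) (suc hi) ≡ true

  short : Bool
  short = 2 * (toℕ hi ∸ toℕ lo) <ᵇ m

  arcLength : ℕ
  arcLength = minorArc m (toℕ hi ∸ toℕ lo)

  Behind : Fin m → Set
  Behind x = spokeCross m (toℕ x) (toℕ lo) (toℕ hi) ≡ true

  behind⇔openArc : ∀ {x} → Behind x ⇔ OpenArc short (toℕ lo) (toℕ hi) (toℕ x)
  behind⇔openArc = openArc⇔ (<⇒≤ lo<hi) short ⇔-∘ spokeCross≡true⇔ {m = m} (<⇒≤ lo<hi)

open Chord

module PlaneConnected {m : ℕ} {G : Graph m}
         (G-sym : ∀ p q → G p q ≡ G q p) (G-irrefl : ∀ p → G p p ≡ false)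
         (connected : Connected m G) (plane : IsPlane m G) where

  rimNeighbour : (v : Fin m) → G (suc v) zero ≢ true →
                 Σ (Fin m) λ w → toℕ v ≢ toℕ w × G (suc v) (suc w) ≡ true
  rimNeighbour v no-spoke with incoming (connected zero (suc v)) (λ ())
  ... | zero  , spoke = contradiction (trans (G-sym (suc v) zero) spoke) no-spoke
  ... | suc w , e     = w , v≢w , trans (G-sym (suc v) (suc w)) e
    where
    v≢w : toℕ v ≢ toℕ w
    v≢w v≡w with toℕ-injective v≡w
    ... | refl = contradiction (trans (sym e) (G-irrefl (suc v))) λ ()

  chordBetween : (v w : Fin m) → toℕ v ≢ toℕ w → G (suc v) (suc w) ≡ true → Chord m G
  chordBetween v w v≢w e with <-cmp (toℕ v) (toℕ w)
  ... | tri< v<w _ _ = chord v w v<w e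
  ... | tri≈ _ v≡w _ = contradiction v≡w v≢w
  ... | tri> _ _ w<v = chord w v w<v (trans (G-sym (suc w) (suc v)) e)

  arcLength-chordBetween : ∀ v w v≢w e →
                           arcLength (chordBetween v w v≢w e) ≡ minorArc m ∣ toℕ v - toℕ w ∣
  arcLength-chordBetween v w v≢w e with <-cmp (toℕ v) (toℕ w)
  ... | tri< v<w _ _ = cong (minorArc m) (sym (m≤n⇒∣m-n∣≡n∸m (<⇒≤ v<w)))
  ... | tri≈ _ v≡w _ = contradiction v≡w v≢w
  ... | tri> _ _ w<v = cong (minorArc m) (sym (m≤n⇒∣n-m∣≡n∸m (<⇒≤ w<v)))

  behind⇒¬spoke : (c : Chord m G) {v : Fin m} → Behind c v → G (suc v) zero ≢ true
  behind⇒¬spoke (chord lo hi _ edge) {v} behind spoke =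
    contradiction (trans (sym behind) (plane (suc lo) (suc hi) (suc v) zero edge spoke)) λ ()

  neighbour-in-closedArc : (c : Chord m G) {v w : Fin m} → Behind c v → G (suc v) (suc w) ≡ true →
                           ClosedArc (short c) (toℕ (lo c)) (toℕ (hi c)) (toℕ w)
  neighbour-in-closedArc c@(chord lo hi lo<hi edge) {v} {w} behind e
    with to (spokeCross≡true⇔ {m = m} (<⇒≤ lo<hi)) behind
  ... | v≢lo , v≢hi , v-side =
    closedArc (<⇒≤ lo<hi) (short c)
      (map₂ (map₂ (λ same-side → trans same-side v-side))
        (chordsCross≡false (<⇒≤ lo<hi) v≢lo v≢hi (plane (suc lo) (suc hi) (suc v) (suc w) edge e)))

  boundary⊎behind : (c : Chord m G) → HasBoundaryEdge m G ⊎ Σ (Fin m) (Behind c)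
  boundary⊎behind c@(chord lo hi lo<hi edge) with boundary⊎openArcVertex (short c) lo hi lo<hi
  ... | inj₁ lo→hi             = inj₁ (lo , hi , lo→hi , edge)
  ... | inj₂ (inj₁ hi→lo)      = inj₁ (hi , lo , hi→lo , trans (G-sym (suc hi) (suc lo)) edge)
  ... | inj₂ (inj₂ (x , x-open)) = inj₂ (x , from (behind⇔openArc c) x-open)

  boundary⊎shorter : (c : Chord m G) →
                     HasBoundaryEdge m G ⊎ Σ (Chord m G) λ c′ → arcLength c′ < arcLength c
  boundary⊎shorter c with boundary⊎behind c
  ... | inj₁ boundary = inj₁ boundary
  ... | inj₂ (v , behind) with rimNeighbour v (behind⇒¬spoke c behind)
  ... | w , v≢w , e =
    inj₂ (chordBetween v w v≢w e , subst (_< arcLength c) (sym (arcLength-chordBetween v w v≢w e)) vw-shorter)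
    where
    vw-shorter : minorArc m ∣ toℕ v - toℕ w ∣ < arcLength c
    vw-shorter = minorArc-shrinks (short c) refl (lo<hi c) (toℕ<n (hi c)) (toℕ<n v) (toℕ<n w)
                (to (behind⇔openArc c) behind) (neighbour-in-closedArc c behind e)

  chord⇒boundaryEdge : Chord m G → HasBoundaryEdge m G
  chord⇒boundaryEdge c = descend c (<-wellFounded (arcLength c))
    where
    descend : (c : Chord m G) → Acc _<_ (arcLength c) → HasBoundaryEdge m G
    descend c (acc shorter-accessible) with boundary⊎shorter c
    ... | inj₁ boundary       = boundary
    ... | inj₂ (c′ , shorter) = descend c′ (shorter-accessible shorter)

  missingSpoke⇒boundaryEdge : (v : Fin m) → G (suc v) zero ≢ true → HasBoundaryEdge m G
  missingSpoke⇒boundaryEdge v no-spoke with rimNeighbour v no-spoke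
  ... | w , v≢w , e = chord⇒boundaryEdge (chordBetween v w v≢w e)

lemma3 : (n : ℕ) → 2 ≤ n →
    (T : Fin n → Graph (2 * n ∸ 1)) →
    (∀ i → IsPlaneSpanningTree (2 * n ∸ 1) (T i)) →
    PartitionsComplete (2 * n ∸ 1) n T →
    ∀ i → HasBoundaryEdge (2 * n ∸ 1) (T i)
lemma3 _ (s≤s (s≤s _)) T trees partition i
  with trees i | trees (punchIn i zero)
... | planeᵢ , (symᵢ , irreflᵢ) , connectedᵢ , _ | _ , (_ , irreflⱼ) , connectedⱼ , _
  with connected⇒spoke irreflⱼ connectedⱼ zero
... | v , spokeⱼ =
  PlaneConnected.missingSpoke⇒boundaryEdge symᵢ irreflᵢ connectedᵢ planeᵢ v
    λ spokeᵢ → punchInᵢ≢i i zero (partition-unique partition (λ ()) spokeⱼ spokeᵢ)
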